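{- Let $q \geq 1$ and $r \geq 4$ be integers. Let $G$ be a tree with $q$ edges, let $J \subseteq 2^{[r]}$, and let $H^*$ be a non-empty $(rq,J)$-homogeneous $r$-graph with $\rho(J) \geq r-1$ and $J$ not central. Then $H^*$ contains a copy of the $r$-uniform expansion $G^+$.
   Context: An $r$-graph is a family of $r$-element subsets (edges) of a finite vertex set. The $r$-uniform expansion $G^+$ of a graph $G$ is the $r$-graph $\{e \cup S_e : e \in G\}$ where the sets $S_e$ have size $r-2$, are disjoint from $V(G)$, and are pairwise disjoint for distinct edges. A Delta-system is a family $\triangle$ of sets such that for any distinct $e,f \in \triangle$, $e \cap f = \bigcap_{g \in \triangle} g$; this common intersection is its core. For an $r$-graph $H$ and a vertex set $f$, the core degree $d^*_H(f)$ is the maximum $s$ such that $H$ contains a Delta-system of $s$ edges with core $f$. For an edge $e$, $H|_e = \{e \cap f : f \in H, f \neq e\}$. If $H$ is $r$-partite with parts $(X_1,\dots,X_r)$, let $\mathrm{proj}(g) = \{i : g \cap X_i \neq \emptyset\}$ and $I_H(e) = \{\mathrm{proj}(g) : g \in H|_e\}$. For a positive integer $s$ and $J \subseteq 2^{[r]}$, an $r$-partite $r$-graph $H^*$ with parts $(X_1,\dots,X_r)$ is $(s,J)$-homogeneous if (1) $J$ is closed under intersection, (2) $I_{H^*}(e) = J$ for every $e \in H^*$, and (3) for every $e \in H^*$ and $g \in H^*|_e$, $d^*_{H^*}(g) \geq s$. The rank of $J$ is $\rho(J) = \min\{|e| : e \subseteq [r],\ \text{no member of } J \text{ contains } e\}$.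 $J$ is central if there exists $x \in [r]$ such that $J$ contains every $(r-1)$-subset of $[r]$ containing $x$ but not $[r]\setminus\{x\}$. -}

module Defs where

open import Data.Nat using (ℕ; _≤_; _<_; _∸_)
open import Data.Fin using (Fin)
open import Data.Fin.Subset using (Subset; ⁅_⁆; ∁; ∣_∣; _⊆_) renaming (_∈_ to _∈ₛ_; _∩_ to _∩ₛ_)
open import Data.Vec using (Vec; lookup)
open import Data.List using (List; _∷_; length; _∷ʳ_)
open import Data.List.Membership.Propositional using () renaming (_∈_ to _∈ₗ_)
open import Data.List.Relation.Unary.Unique.Propositional using (Unique)
open import Data.List.Relation.Unary.Linked using (Linked)
open import Data.Product using (Σ; ∃; ∃-syntax; _×_; _,_; proj₁; proj₂; swap)
open import Data.Sum using (_⊎_; inj₁; inj₂)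
open import Relation.Nullary using (¬_)
open import Relation.Binary.PropositionalEquality using (_≡_; _≢_)
open import Relation.Binary.Construct.Closure.ReflexiveTransitive using (Star)
open import Function.Bundles using (_⇔_)
open import Function.Definitions using (Injective)

record Graph (n q : ℕ) : Set where
  field
    ends     : Fin q → Fin n × Fin n
    loopless : ∀ j → proj₁ (ends j) ≢ proj₂ (ends j)
    simple   : ∀ j k → j ≢ k → ¬ (ends j ≡ ends k ⊎ ends j ≡ swap (ends k))
open Graph public

Adj : ∀ {n q} → Graph n q → Fin n → Fin n → Set
Adj G u v = ∃[ j ] (ends G j ≡ (u , v) ⊎ ends G j ≡ (v , u))

Connected : ∀ {n q} → Graph n q → Set
Connected G = ∀ u v → Star (Adj G) u v

HasCycle : ∀ {n q} → Graph n q → Set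
HasCycle {n} G = ∃[ v ] ∃[ ws ]
  (2 ≤ length ws × Unique (v ∷ ws) × Linked (Adj G) ((v ∷ ws) ∷ʳ v))

IsTree : ∀ {n q} → Graph n q → Set
IsTree G = Connected G × ¬ HasCycle G

-- r-partite r-graphs with parts X_1..X_r.  The vertex set is Fin r × ℕ,
-- with X_i = {i} × ℕ; an edge has exactly one vertex in each part and is
-- encoded by the vector of its ℕ-coordinates.

Vertex : ℕ → Set
Vertex r = Fin r × ℕ

Edge : ℕ → Set
Edge r = Vec ℕ r

PGraph : ℕ → Set
PGraph r = List (Edge r)

VSet : ℕ → Set₁
VSet r = Vertex r → Set

_∈E_ : ∀ {r} → Vertex r → Edge r → Set
(i , x) ∈E e = lookup e i ≡ x

edgeSet : ∀ {r} → Edge r → VSet r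
edgeSet e v = v ∈E e

_∩ᵥ_ : ∀ {r} → VSet r → VSet r → VSet r
(A ∩ᵥ B) v = A v × B v

_≐_ : ∀ {r} → VSet r → VSet r → Set
A ≐ B = ∀ v → A v ⇔ B v

InRestr : ∀ {r} → PGraph r → Edge r → VSet r → Set
InRestr H e g = ∃[ f ] (f ∈ₗ H × f ≢ e × g ≐ (edgeSet e ∩ᵥ edgeSet f))

IsProj : ∀ {r} → Subset r → VSet r → Set
IsProj A g = ∀ i → (i ∈ₛ A ⇔ (∃[ x ] g (i , x)))

IEquals : ∀ {r} → PGraph r → Edge r → (Subset r → Set) → Set₁
IEquals H e J = ∀ A → (J A ⇔ (∃[ g ] (InRestr H e g × IsProj A g)))

IsDeltaSystem : ∀ {r m} → (Fin m → Edge r) → VSet r → Set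
IsDeltaSystem {r} {m} f g =
  (∀ j k → j ≢ k → f j ≢ f k) ×
  (∀ j k → j ≢ k → (edgeSet (f j) ∩ᵥ edgeSet (f k)) ≐ bigcap) ×
  (g ≐ bigcap)
  where
  bigcap : VSet r
  bigcap v = ∀ j → v ∈E f j

CoreDegAtLeast : ∀ {r} → PGraph r → VSet r → ℕ → Set
CoreDegAtLeast H g s = ∃[ m ] (s ≤ m × ∃[ f ] ((∀ j → f j ∈ₗ H) × IsDeltaSystem {m = m} f g))

Homogeneous : ∀ {r} → ℕ → (Subset r → Set) → PGraph r → Set₁
Homogeneous s J H =
  (∀ A B → J A → J B → J (A ∩ₛ B)) ×
  (∀ e → e ∈ₗ H → IEquals H e J) ×
  (∀ e → e ∈ₗ H → (g : VSet _) → InRestr H e g → CoreDegAtLeast H g s)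

-- ρ(J) ≥ k  (unfolding of: min{|A| : no member of J contains A} ≥ k)
RankAtLeast : ∀ {r} → (Subset r → Set) → ℕ → Set
RankAtLeast J k = ∀ A → ∣ A ∣ < k → ∃[ B ] (J B × A ⊆ B)

Central : ∀ {r} → (Subset r → Set) → Set
Central {r} J = ∃[ x ]
  ((∀ A → ∣ A ∣ ≡ r ∸ 1 → x ∈ₛ A → J A) × ¬ J (∁ ⁅ x ⁆))

-- r-uniform expansion G⁺: vertices V(G) ⊎ (edge index × Fin (r-2));
-- edge j of G⁺ is ends j ∪ {(j,k) : k}.

ExpVertex : ℕ → ℕ → ℕ → Set
ExpVertex n q r = Fin n ⊎ (Fin q × Fin (r ∸ 2))

InExpEdge : ∀ {n q} → Graph n q → (r : ℕ) → Fin q → ExpVertex n q r → Set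
InExpEdge G r j (inj₁ u) = u ≡ proj₁ (ends G j) ⊎ u ≡ proj₂ (ends G j)
InExpEdge G r j (inj₂ (j' , _)) = j' ≡ j

ContainsExpansion : ∀ {n q r} → Graph n q → PGraph r → Set
ContainsExpansion {n} {q} {r} G H =
  ∃[ φ ] (Injective _≡_ _≡_ φ ×
    (∀ j → ∃[ h ] (h ∈ₗ H ×
      (∀ w → (w ∈E h) ⇔ (∃[ y ] (InExpEdge G r j y × φ y ≡ w))))))

-- Two properties of J drive the proof. First, J contains two singletons {a} and {b}. Indeed J is closed
-- under intersection and does not contain [r] (an edge meets no other edge in all r parts); by the rank
-- condition every set [r] ∖ {l, l′} lies in a member of J, which must then be [r] ∖ {l}, [r] ∖ {l′} or
-- [r] ∖ {l, l′}, and non-centrality rules out the single pattern of missing sets [r] ∖ {l} under which no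
-- point i could be cut out as an intersection of members of J. Second, a vertex v of H* in part a or b is
-- the core of a Delta-system of at least rq edges, so for any set U of fewer than rq vertices some edge
-- through v meets U only in v. The tree is then embedded greedily, one pendant edge at a time: its two colour
-- classes go to parts a and b, and a new edge is a petal through the image of its old endpoint avoiding the
-- at most 1 + (r - 1)(q - 1) < rq vertices used so far.

module Submission where

open import Defs
open import Data.Bool using (Bool; true; false; not)
open import Data.Nat as ℕ using (ℕ; zero; suc; _≤_; _<_; _+_; _*_; _∸_; s≤s; z≤n)
import Data.Nat.Properties as ℕ
open import Data.Fin as Fin using (Fin; punchIn; punchOut)
open import Data.Fin.Properties
  using (all?; any?; ¬∀⟶∃¬; injective⇒≤; punchIn-injective; punchInᵢ≢i; punchIn-punchOut)
  renaming (_≟_ to _≟ᶠ_)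
open import Data.Fin.Subset using (Subset; ⁅_⁆; ∁; ∣_∣; _⊆_; ⊤; _∩_; _∈_; _∉_)
open import Data.Fin.Subset.Properties
  using (_∈?_; ⊆-antisym; ∈⊤; x∈⁅x⁆; x∈⁅y⁆⇒x≡y; x≢y⇒x∉⁅y⁆; x∉⁅y⁆⇒x≢y; x∈∁p⇒x∉p; x∉p⇒x∈∁p;
         x∈p∩q⁺; x∈p∩q⁻; ∣⊤∣≡n; p⊂q⇒∣p∣<∣q∣; ∣∁p∣≡n∸∣p∣; ∣⁅x⁆∣≡1)
open import Data.Vec using (Vec; lookup)
open import Data.Vec.Properties using (tabulate∘lookup; tabulate-cong) renaming (≡-dec to ≡-decᵛ)
open import Data.Vec.Functional using (updateAt)
open import Data.Vec.Functional.Properties using (updateAt-updates; updateAt-minimal)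
open import Data.List as L using (List; []; _∷_; length; _++_; _∷ʳ_; tabulate; allFin)
import Data.List.Properties as L
open import Data.List.Membership.Propositional using (find; lose) renaming (_∈_ to _∈ₗ_; _∉_ to _∉ₗ_)
open import Data.List.Membership.Propositional.Properties
  using (∈-allFin; ∈-lookup; ∈-++⁺ˡ; ∈-++⁺ʳ; ∈-tabulate⁺; ∈-map⁺)
open import Data.List.Relation.Unary.All as All using (All; []; _∷_)
import Data.List.Relation.Unary.All.Properties as All
open import Data.List.Relation.Unary.Any as Any using (here; there)
open import Data.List.Relation.Unary.Any.Properties using (lookup-index)
open import Data.List.Relation.Unary.AllPairs using ([]; _∷_)
open import Data.List.Relation.Unary.Linked using (Linked; [-]; _∷_)
open import Data.List.Relation.Unary.Unique.Propositional using (Unique)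
import Data.List.Relation.Unary.Unique.Propositional.Properties as Unique
open import Data.Empty using (⊥-elim)
open import Data.Product using (∃-syntax; _×_; _,_; proj₁; proj₂; swap; uncurry)
open import Data.Sum using (_⊎_; inj₁; inj₂; [_,_]′)
open import Function using (_∘_; const)
open import Function.Bundles using (_⇔_; mk⇔; Equivalence)
open import Function.Definitions using (Injective)
open import Relation.Binary.Construct.Closure.ReflexiveTransitive using (Star; ε; _◅_)
open import Relation.Binary.PropositionalEquality
  using (_≡_; _≢_; refl; sym; trans; cong; cong₂; subst; subst₂; module ≡-Reasoning)
open import Relation.Nullary using (¬_; Dec; yes; no; ¬?; contradiction; _×-dec_; _→-dec_)
open import Relation.Nullary.Decidable using (map′; _⊎-dec_)
open import Relation.Unary using (Decidable)
open Equivalence using (to; from)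

private variable
  r : ℕ

vec-ext : ∀ {n} {xs ys : Vec ℕ n} → (∀ i → lookup xs i ≡ lookup ys i) → xs ≡ ys
vec-ext {xs = xs} {ys} eq = trans (sym (tabulate∘lookup xs)) (trans (tabulate-cong eq) (tabulate∘lookup ys))

_⇔-dec_ : ∀ {A B : Set} → Dec A → Dec B → Dec (A ⇔ B)
a? ⇔-dec b? = map′ (uncurry mk⇔) (λ e → to e , from e) ((a? →-dec b?) ×-dec (b? →-dec a?))

_∈ₗ?_ : ∀ {m} (x : Fin m) xs → Dec (x ∈ₗ xs)
x ∈ₗ? xs = Any.any? (x ≟ᶠ_) xs

fresh : ∀ {m} (xs : List (Fin m)) → length xs < m → ∃[ j ] (j ∉ₗ xs)
fresh {m} xs |xs|<m = ¬∀⟶∃¬ m (_∈ₗ xs) (_∈ₗ? xs) (λ all∈ → ℕ.<⇒≱ |xs|<m (injective⇒≤ (index-injective all∈)))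
  where
  index-injective : (all∈ : ∀ j → j ∈ₗ xs) → Injective _≡_ _≡_ (λ j → Any.index (all∈ j))
  index-injective all∈ {i} {j} eq = begin
    i                               ≡⟨ lookup-index (all∈ i) ⟩
    L.lookup xs (Any.index (all∈ i)) ≡⟨ cong (L.lookup xs) eq ⟩
    L.lookup xs (Any.index (all∈ j)) ≡⟨ sym (lookup-index (all∈ j)) ⟩
    j                               ∎
    where open ≡-Reasoning

Unique⇒length≤ : ∀ {m} {xs : List (Fin m)} → Unique xs → length xs ≤ m
Unique⇒length≤ {xs = xs} uniq = injective⇒≤ (lookup-injective uniq)
  where
  lookup-injective : ∀ {ys : List (Fin _)} → Unique ys → ∀ {i j} → L.lookup ys i ≡ L.lookup ys j → i ≡ j
  lookup-injective (_ ∷ _) {Fin.zero} {Fin.zero} _ = refl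
  lookup-injective (y∉ ∷ _) {Fin.zero} {Fin.suc j} y≡ = contradiction y≡ (All.lookup y∉ (∈-lookup j))
  lookup-injective (y∉ ∷ _) {Fin.suc i} {Fin.zero} ≡y = contradiction (sym ≡y) (All.lookup y∉ (∈-lookup i))
  lookup-injective (_ ∷ uniq) {Fin.suc i} {Fin.suc j} eq = cong Fin.suc (lookup-injective uniq eq)

Unique-∷ʳ : ∀ {A : Set} {xs : List A} {y} → Unique xs → y ∉ₗ xs → Unique (xs ∷ʳ y)
Unique-∷ʳ uniq y∉xs = Unique.++⁺ uniq ([] ∷ []) λ { (y∈xs , here refl) → y∉xs y∈xs }

not-≢ : ∀ c → not c ≢ c
not-≢ true ()
not-≢ false ()

∈∁⁅⁆⁺ : ∀ {y l : Fin r} → y ≢ l → y ∈ ∁ ⁅ l ⁆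
∈∁⁅⁆⁺ = x∉p⇒x∈∁p ∘ x≢y⇒x∉⁅y⁆

∈∁⁅⁆⁻ : ∀ {y l : Fin r} → y ∈ ∁ ⁅ l ⁆ → y ≢ l
∈∁⁅⁆⁻ = x∉⁅y⁆⇒x≢y ∘ x∈∁p⇒x∉p

∣∁⁅⁆∣ : (l : Fin r) → ∣ ∁ ⁅ l ⁆ ∣ ≡ r ∸ 1
∣∁⁅⁆∣ {r} l = trans (∣∁p∣≡n∸∣p∣ ⁅ l ⁆) (cong (r ∸_) (∣⁅x⁆∣≡1 l))

coatom-of-size : 1 ≤ r → (A : Subset r) → ∣ A ∣ ≡ r ∸ 1 → ∃[ l ] (A ≡ ∁ ⁅ l ⁆)
coatom-of-size {r} 1≤r A |A| with ¬∀⟶∃¬ r (_∈ A) (_∈? A) A≢⊤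
  where
  A≢⊤ : ¬ (∀ y → y ∈ A)
  A≢⊤ all∈ = ℕ.<⇒≢ (ℕ.∸-monoʳ-< (s≤s z≤n) 1≤r)
                   (trans (sym |A|) (trans (cong ∣_∣ (⊆-antisym (λ _ → ∈⊤) (λ {y} _ → all∈ y))) (∣⊤∣≡n r)))
... | l , l∉A = l , ⊆-antisym (λ y∈A → ∈∁⁅⁆⁺ λ { refl → l∉A y∈A }) ∁⁅l⁆⊆A
  where
  ∁⁅l⁆⊆A : ∁ ⁅ l ⁆ ⊆ A
  ∁⁅l⁆⊆A {y} y∈∁⁅l⁆ with y ∈? A
  ... | yes y∈A = y∈A
  ... | no y∉A = contradiction (trans |A| (sym (∣∁⁅⁆∣ l)))
                   (ℕ.<⇒≢ (p⊂q⇒∣p∣<∣q∣ ((λ z∈A → ∈∁⁅⁆⁺ λ { refl → l∉A z∈A }) , y , y∈∁⁅l⁆ , y∉A)))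

module _ {m} {a b : Fin (suc (suc m))} (a≢b : a ≢ b) where

  punchIn₂ : Fin m → Fin (suc (suc m))
  punchIn₂ k = punchIn a (punchIn (punchOut a≢b) k)

  punchIn₂-injective : ∀ {k k′} → punchIn₂ k ≡ punchIn₂ k′ → k ≡ k′
  punchIn₂-injective = punchIn-injective _ _ _ ∘ punchIn-injective a _ _

  punchIn₂≢a : ∀ k → punchIn₂ k ≢ a
  punchIn₂≢a k = punchInᵢ≢i a _

  punchIn₂≢b : ∀ k → punchIn₂ k ≢ b
  punchIn₂≢b k eq = punchInᵢ≢i (punchOut a≢b) k (punchIn-injective a _ _ (trans eq (sym (punchIn-punchOut a≢b))))

  punchIn₂-onto : ∀ {p} → p ≢ a → p ≢ b → ∃[ k ] (punchIn₂ k ≡ p)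
  punchIn₂-onto {p} p≢a p≢b =
    punchOut b′≢p′ , trans (cong (punchIn a) (punchIn-punchOut b′≢p′)) (punchIn-punchOut a≢p)
    where
    a≢p = p≢a ∘ sym
    b′≢p′ : punchOut a≢b ≢ punchOut a≢p
    b′≢p′ eq = p≢b (begin
      p                             ≡⟨ punchIn-punchOut a≢p ⟨
      punchIn a (punchOut a≢p)      ≡⟨ cong (punchIn a) eq ⟨
      punchIn a (punchOut a≢b)      ≡⟨ punchIn-punchOut a≢b ⟩
      b                             ∎)
      where open ≡-Reasoning

MeetsIn : Edge r → Edge r → Subset r → Set
MeetsIn e f A = ∀ i → i ∈ A ⇔ lookup e i ≡ lookup f i

module _ {H : PGraph r} {e : Edge r} {J : Subset r → Set} (I≡J : IEquals H e J) where

  J⇒meeting : ∀ {A} → J A → ∃[ f ] (f ∈ₗ H × f ≢ e × MeetsIn e f A)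
  J⇒meeting {A} JA with to (I≡J A) JA
  ... | g , (f , f∈H , f≢e , g≐e∩f) , A≡proj-g = f , f∈H , f≢e , λ i → mk⇔
    (λ i∈A → let (x , gx) = to (A≡proj-g i) i∈A ; (ex , fx) = to (g≐e∩f (i , x)) gx in trans ex (sym fx))
    (λ eᵢ≡fᵢ → from (A≡proj-g i) (lookup e i , from (g≐e∩f (i , lookup e i)) (refl , sym eᵢ≡fᵢ)))

  meeting⇒J : ∀ {A f} → f ∈ₗ H → f ≢ e → MeetsIn e f A → J A
  meeting⇒J {A} {f} f∈H f≢e meets = from (I≡J A)
    ( (edgeSet e ∩ᵥ edgeSet f) , (f , f∈H , f≢e , λ v → mk⇔ (λ z → z) (λ z → z))
    , λ i → mk⇔ (λ i∈A → lookup e i , refl , sym (to (meets i) i∈A))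
                (λ { (x , ex , fx) → from (meets i) (trans ex (sym fx)) }))

  J-decidable : Decidable J
  J-decidable A = map′ (λ found → let (f , f∈H , f≢e , meets) = find {P = Meets} found in meeting⇒J f∈H f≢e meets)
                       (λ JA → let (f , f∈H , met) = J⇒meeting JA in lose f∈H met)
                       (Any.any? meets? H)
    where
    Meets : Edge _ → Set
    Meets f = f ≢ e × MeetsIn e f A
    meets? : ∀ f → Dec (Meets f)
    meets? f = ¬? (≡-decᵛ ℕ._≟_ f e) ×-dec all? (λ i → (i ∈? A) ⇔-dec (lookup e i ℕ.≟ lookup f i))

  ⊤∉J : ¬ J ⊤
  ⊤∉J J⊤ = let (f , _ , f≢e , meets) = J⇒meeting J⊤ in f≢e (vec-ext (λ i → sym (to (meets i) ∈⊤)))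

module _ {J : Subset r → Set} where

  Separates : Fin r → Fin r → Set
  Separates i l = ∃[ B ] (J B × i ∈ B × l ∉ B)

  Coatom : Fin r → Set
  Coatom l = J (∁ ⁅ l ⁆)

  separates-by-coatom : ∀ {i l} → Coatom l → i ≢ l → Separates i l
  separates-by-coatom Jl i≢l = ∁ ⁅ _ ⁆ , Jl , ∈∁⁅⁆⁺ i≢l , λ l∈ → ∈∁⁅⁆⁻ l∈ refl

  singleton-by-separation : (∀ A B → J A → J B → J (A ∩ B)) →
    ∀ {i l₀} → l₀ ≢ i → (∀ l → l ≢ i → Separates i l) → J ⁅ i ⁆
  singleton-by-separation ∩-closed {i} {l₀} l₀≢i separate with separating (allFin r)
    where
    separating : (ls : List (Fin r)) → ∃[ B ] (J B × i ∈ B × All (λ l → l ≢ i → l ∉ B) ls)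
    separating [] = let (B , JB , i∈B , _) = separate l₀ l₀≢i in B , JB , i∈B , []
    separating (l ∷ ls) with separating ls | l ≟ᶠ i
    ... | B , JB , i∈B , sep | yes l≡i = B , JB , i∈B , (λ l≢i → contradiction l≡i l≢i) ∷ sep
    ... | B , JB , i∈B , sep | no l≢i =
      let (B′ , JB′ , i∈B′ , l∉B′) = separate l l≢i in
      B ∩ B′ , ∩-closed B B′ JB JB′ , x∈p∩q⁺ (i∈B , i∈B′) ,
      (λ _ l∈ → l∉B′ (proj₂ (x∈p∩q⁻ B B′ l∈))) ∷
      All.map (λ l∉B y≢i y∈ → l∉B y≢i (proj₁ (x∈p∩q⁻ B B′ y∈))) sep
  ... | B , JB , i∈B , sep = subst J (⊆-antisym B⊆⁅i⁆ ⁅i⁆⊆B) JB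
    where
    B⊆⁅i⁆ : B ⊆ ⁅ i ⁆
    B⊆⁅i⁆ {y} y∈B with y ≟ᶠ i
    ... | yes refl = x∈⁅x⁆ i
    ... | no y≢i = contradiction y∈B (All.lookup sep (∈-allFin y) y≢i)
    ⁅i⁆⊆B : ⁅ i ⁆ ⊆ B
    ⁅i⁆⊆B y∈⁅i⁆ = subst (_∈ B) (sym (x∈⁅y⁆⇒x≡y i y∈⁅i⁆)) i∈B

  pair-cover : RankAtLeast J (r ∸ 1) → ∀ {l l′} → l ≢ l′ → ∃[ B ] (J B × (∀ {y} → y ≢ l → y ≢ l′ → y ∈ B))
  pair-cover rank {l} {l′} l≢l′ with rank (∁ ⁅ l ⁆ ∩ ∁ ⁅ l′ ⁆) |A|<r-1
    where
    |A|<r-1 : ∣ ∁ ⁅ l ⁆ ∩ ∁ ⁅ l′ ⁆ ∣ < r ∸ 1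
    |A|<r-1 = subst (∣ ∁ ⁅ l ⁆ ∩ ∁ ⁅ l′ ⁆ ∣ <_) (∣∁⁅⁆∣ l) (p⊂q⇒∣p∣<∣q∣
      ( (λ {y} y∈ → proj₁ (x∈p∩q⁻ (∁ ⁅ l ⁆) _ y∈))
      , l′ , ∈∁⁅⁆⁺ (l≢l′ ∘ sym) , λ l′∈ → ∈∁⁅⁆⁻ (proj₂ (x∈p∩q⁻ _ (∁ ⁅ l′ ⁆) l′∈)) refl))
  ... | B , JB , A⊆B = B , JB , λ y≢l y≢l′ → A⊆B (x∈p∩q⁺ (∈∁⁅⁆⁺ y≢l , ∈∁⁅⁆⁺ y≢l′))

  -- The member B of J covering all of [r] but l and l′ is not [r], and it is not [r] ∖ {l′}; so it misses l.
  separates-by-pair : ¬ J ⊤ → RankAtLeast J (r ∸ 1) →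
    ∀ {i l l′} → ¬ Coatom l′ → i ≢ l → i ≢ l′ → l ≢ l′ → Separates i l
  separates-by-pair ⊤∉J rank {i} {l} {l′} ¬Jl′ i≢l i≢l′ l≢l′ with pair-cover rank l≢l′
  ... | B , JB , covers with l ∈? B | l′ ∈? B
  ...   | no l∉B  | _       = B , JB , covers i≢l i≢l′ , l∉B
  ...   | yes l∈B | yes l′∈B = contradiction (subst J (⊆-antisym (λ _ → ∈⊤) (λ _ → everything)) JB) ⊤∉J
    where
    everything : ∀ {y} → y ∈ B
    everything {y} with y ≟ᶠ l | y ≟ᶠ l′
    ... | yes refl | _ = l∈B
    ... | no _ | yes refl = l′∈B
    ... | no y≢l | no y≢l′ = covers y≢l y≢l′
  ...   | yes l∈B | no l′∉B = contradiction (subst J (⊆-antisym B⊆∁⁅l′⁆ ∁⁅l′⁆⊆B) JB) ¬Jl′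
    where
    B⊆∁⁅l′⁆ : B ⊆ ∁ ⁅ l′ ⁆
    B⊆∁⁅l′⁆ y∈B = ∈∁⁅⁆⁺ λ { refl → l′∉B y∈B }
    ∁⁅l′⁆⊆B : ∁ ⁅ l′ ⁆ ⊆ B
    ∁⁅l′⁆⊆B {y} y∈ with y ≟ᶠ l
    ... | yes refl = l∈B
    ... | no y≢l = covers y≢l (∈∁⁅⁆⁻ y∈)

  coatom-by-noncentrality : 1 ≤ r → Decidable J → ¬ Central J →
    ∀ x → (∀ l → l ≢ x → Coatom l) → Coatom x
  coatom-by-noncentrality 1≤r J? noncentral x coatoms with J? (∁ ⁅ x ⁆)
  ... | yes Jx = Jx
  ... | no ¬Jx = contradiction (x , contains-coatoms-through-x , ¬Jx) noncentral
    where
    contains-coatoms-through-x : ∀ A → ∣ A ∣ ≡ r ∸ 1 → x ∈ A → J A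
    contains-coatoms-through-x A |A| x∈A with coatom-of-size 1≤r A |A|
    ... | l , refl = coatoms l (λ { refl → ∈∁⁅⁆⁻ x∈A refl })

  two-singletons : 4 ≤ r → (∀ A B → J A → J B → J (A ∩ B)) → Decidable J → ¬ J ⊤ →
    RankAtLeast J (r ∸ 1) → ¬ Central J → ∃[ a ] ∃[ b ] (a ≢ b × J ⁅ a ⁆ × J ⁅ b ⁆)
  two-singletons 4≤r ∩-closed J? ⊤∉J rank noncentral
    with all? (λ l → J? (∁ ⁅ l ⁆))
  ... | yes coatoms =
    let (a , a∉[]) = fresh [] (ℕ.≤-trans (s≤s z≤n) 4≤r)
        (b , b∉[a]) = fresh (a ∷ []) (ℕ.≤-trans (s≤s (s≤s z≤n)) 4≤r)
        b≢a = b∉[a] ∘ here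
    in a , b , b≢a ∘ sym , singleton b≢a , singleton (b≢a ∘ sym)
    where
    singleton : ∀ {i l₀} → l₀ ≢ i → J ⁅ i ⁆
    singleton l₀≢i = singleton-by-separation ∩-closed l₀≢i (λ l l≢i → separates-by-coatom (coatoms l) (l≢i ∘ sym))
  ... | no ¬coatoms
    with ¬∀⟶∃¬ r Coatom (J? ∘ ∁ ∘ ⁅_⁆) ¬coatoms
  ... | u , ¬Ju
    with ¬∀⟶∃¬ r (λ v → v ≢ u → Coatom v) (λ v → ¬? (v ≟ᶠ u) →-dec J? (∁ ⁅ v ⁆))
               (¬Ju ∘ coatom-by-noncentrality (ℕ.≤-trans (s≤s z≤n) 4≤r) J? noncentral u)
  ... | v , ¬[v≢u→Jv] =
    let v≢u = λ v≡u → ¬[v≢u→Jv] (λ v≢u → contradiction v≡u v≢u)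
        ¬Jv = λ Jv → ¬[v≢u→Jv] (λ _ → Jv)
        (a , a∉[uv]) = fresh (u ∷ v ∷ []) (ℕ.≤-trans (s≤s (s≤s (s≤s z≤n))) 4≤r)
        (b , b∉[uva]) = fresh (u ∷ v ∷ a ∷ []) 4≤r
    in a , b , (λ a≡b → b∉[uva] (there (there (here (sym a≡b))))) ,
       singleton v≢u ¬Jv (a∉[uv] ∘ here) (a∉[uv] ∘ there ∘ here) ,
       singleton v≢u ¬Jv (b∉[uva] ∘ here) (b∉[uva] ∘ there ∘ here)
    where
    -- two non-coatoms u ≠ v away from i let every l ≠ i be separated from i through the pair {l, u} or {l, v}
    singleton : ∀ {i} → v ≢ u → ¬ Coatom v → i ≢ u → i ≢ v → J ⁅ i ⁆
    singleton {i} v≢u ¬Jv i≢u i≢v = singleton-by-separation ∩-closed (i≢u ∘ sym) separate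
      where
      separate : ∀ l → l ≢ i → Separates i l
      separate l l≢i with J? (∁ ⁅ l ⁆) | l ≟ᶠ u
      ... | yes Jl | _ = separates-by-coatom Jl (l≢i ∘ sym)
      ... | no _ | yes refl = separates-by-pair ⊤∉J rank ¬Jv (l≢i ∘ sym) i≢v (v≢u ∘ sym)
      ... | no _ | no l≢u = separates-by-pair ⊤∉J rank ¬Ju (l≢i ∘ sym) i≢u l≢u

module _ {m} {f : Fin m → Edge r} {g : VSet r} (Δ : IsDeltaSystem f g) where

  blocking-petals : (U : List (Vertex r)) →
    ∃[ T ] (length T ≤ length U × (∀ t → t ∉ₗ T → ∀ v → v ∈ₗ U → v ∈E f t → g v))
  blocking-petals [] = [] , z≤n , λ _ _ _ ()
  blocking-petals (v ∷ U) with blocking-petals U | any? (λ t → lookup (f t) (proj₁ v) ℕ.≟ proj₂ v)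
  ... | T , |T|≤|U| , avoid | no v∉petals =
    T , ℕ.m≤n⇒m≤1+n |T|≤|U| , λ { t t∉T w (here refl) w∈ft → contradiction (t , w∈ft) v∉petals
                                ; t t∉T w (there w∈U) → avoid t t∉T w w∈U }
  ... | T , |T|≤|U| , avoid | yes (t₀ , v∈ft₀) =
    t₀ ∷ T , s≤s |T|≤|U| , λ { t t∉T w (here refl) w∈ft → in-core (t∉T ∘ here ∘ sym) v∈ft₀ w∈ft
                             ; t t∉T w (there w∈U) → avoid t (t∉T ∘ there) w w∈U }
    where
    in-core : ∀ {t t′ w} → t ≢ t′ → w ∈E f t → w ∈E f t′ → g w
    in-core {w = w} t≢t′ w∈ft w∈ft′ =
      from (proj₂ (proj₂ Δ) w) (to (proj₁ (proj₂ Δ) _ _ t≢t′ w) (w∈ft , w∈ft′))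

  petal-avoiding : (U : List (Vertex r)) → length U < m → ∃[ t ] (∀ v → v ∈ₗ U → v ∈E f t → g v)
  petal-avoiding U |U|<m with blocking-petals U
  ... | T , |T|≤|U| , avoid = let (t , t∉T) = fresh T (ℕ.≤-<-trans |T|≤|U| |U|<m) in t , avoid t t∉T

singleton-trace : ∀ {H : PGraph r} {e g p} → InRestr H e g → IsProj ⁅ p ⁆ g →
  ∀ v → g v ⇔ v ≡ (p , lookup e p)
singleton-trace {e = e} {g} {p} (f , _ , _ , g≐e∩f) proj-g≡⁅p⁆ v = mk⇔ (in-g⇒≡ v) ≡⇒in-g
  where
  in-g⇒≡ : ∀ v → g v → v ≡ (p , lookup e p)
  in-g⇒≡ (i , y) gv with x∈⁅y⁆⇒x≡y p (from (proj-g≡⁅p⁆ i) (y , gv))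
  ... | refl = cong (p ,_) (sym (proj₁ (to (g≐e∩f (p , y)) gv)))
  ≡⇒in-g : v ≡ (p , lookup e p) → g v
  ≡⇒in-g refl with to (proj-g≡⁅p⁆ p) (x∈⁅x⁆ p)
  ... | y , gy with in-g⇒≡ (p , y) gy
  ... | refl = gy

petal : ∀ {s J} {H : PGraph r} → Homogeneous s J H → ∀ {e v} → J ⁅ proj₁ v ⁆ → e ∈ₗ H → v ∈E e →
  (U : List (Vertex r)) → length U < s → ∃[ P ] (P ∈ₗ H × v ∈E P × (∀ u → u ∈ₗ U → u ∈E P → u ≡ v))
petal (_ , I≡J , core-degree) {e} {p , _} Jp e∈H refl U |U|<s
  with to (I≡J e e∈H ⁅ p ⁆) Jp
... | g , g∈H|e , proj-g≡⁅p⁆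
  with core-degree e e∈H g g∈H|e
... | m , s≤m , f , f∈H , Δ
  with petal-avoiding Δ U (ℕ.<-≤-trans |U|<s s≤m)
... | t , avoids = f t , f∈H t , core⊆ft , λ u u∈U u∈ft → to (trace u) (avoids u u∈U u∈ft)
  where
  trace = singleton-trace g∈H|e proj-g≡⁅p⁆
  core⊆ft : lookup (f t) p ≡ lookup e p
  core⊆ft = to (proj₂ (proj₂ Δ) (p , lookup e p)) (from (trace _) refl) t

module _ {n q} (G : Graph n q) where

  end₁ end₂ : Fin q → Fin n
  end₁ j = proj₁ (ends G j)
  end₂ j = proj₂ (ends G j)

  Joins : Fin q → Fin n → Fin n → Set
  Joins j u w = ends G j ≡ (u , w) ⊎ ends G j ≡ (w , u)

  Joins-sym : ∀ {j u w} → Joins j u w → Joins j w u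
  Joins-sym = [ inj₂ , inj₁ ]′

  Joins-ends : ∀ {j s w} → Joins j s w → (end₁ j ≡ s × end₂ j ≡ w) ⊎ (end₁ j ≡ w × end₂ j ≡ s)
  Joins-ends (inj₁ eq) = inj₁ (cong proj₁ eq , cong proj₂ eq)
  Joins-ends (inj₂ eq) = inj₂ (cong proj₁ eq , cong proj₂ eq)

  Endpoint : Fin q → Fin n → Set
  Endpoint j u = u ≡ end₁ j ⊎ u ≡ end₂ j

  Joins-endpoint : ∀ {j s w u} → Joins j s w → Endpoint j u → u ≡ s ⊎ u ≡ w
  Joins-endpoint (inj₁ eq) (inj₁ u≡) = inj₁ (trans u≡ (cong proj₁ eq))
  Joins-endpoint (inj₁ eq) (inj₂ u≡) = inj₂ (trans u≡ (cong proj₂ eq))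
  Joins-endpoint (inj₂ eq) (inj₁ u≡) = inj₂ (trans u≡ (cong proj₁ eq))
  Joins-endpoint (inj₂ eq) (inj₂ u≡) = inj₁ (trans u≡ (cong proj₂ eq))

  Joins-∈ : ∀ {S : List (Fin n)} {j u w} → Joins j u w → end₁ j ∈ₗ S → end₂ j ∈ₗ S → w ∈ₗ S
  Joins-∈ {S} (inj₁ eq) _ ∈₂ = subst (_∈ₗ S) (cong proj₂ eq) ∈₂
  Joins-∈ {S} (inj₂ eq) ∈₁ _ = subst (_∈ₗ S) (cong proj₁ eq) ∈₁

  Joins-parallel : ∀ {j j′ u w} → Joins j u w → Joins j′ u w → ends G j ≡ ends G j′ ⊎ ends G j ≡ swap (ends G j′)
  Joins-parallel (inj₁ eq) (inj₁ eq′) = inj₁ (trans eq (sym eq′))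
  Joins-parallel (inj₁ eq) (inj₂ eq′) = inj₂ (trans eq (sym (cong swap eq′)))
  Joins-parallel (inj₂ eq) (inj₁ eq′) = inj₂ (trans eq (sym (cong swap eq′)))
  Joins-parallel (inj₂ eq) (inj₂ eq′) = inj₁ (trans eq (sym eq′))

  data Path : Fin n → Fin n → List (Fin n) → Set where
    [_] : ∀ v → Path v v (v ∷ [])
    _∷_ : ∀ {u v t vs} → Adj G u v → Path v t vs → Path u t (u ∷ vs)

  _∷ʳᵖ_ : ∀ {u t w vs} → Path u t vs → Adj G t w → Path u w (vs ∷ʳ w)
  [ v ] ∷ʳᵖ t~w = t~w ∷ [ _ ]
  (u~v ∷ p) ∷ʳᵖ t~w = u~v ∷ (p ∷ʳᵖ t~w)

  Path⇒Linked : ∀ {u t vs} → Path u t vs → Linked (Adj G) vs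
  Path⇒Linked [ v ] = [-]
  Path⇒Linked (u~v ∷ [ v ]) = u~v ∷ [-]
  Path⇒Linked (u~v ∷ p@(_ ∷ _)) = u~v ∷ Path⇒Linked p

  Path-length : ∀ {u t vs} → Path u t vs → u ≢ t → 2 ≤ length vs
  Path-length [ v ] u≢u = contradiction refl u≢u
  Path-length (_ ∷ [ _ ]) _ = s≤s (s≤s z≤n)
  Path-length (_ ∷ (_ ∷ _)) _ = s≤s (s≤s z≤n)

  data Growth : List (Fin n) → List (Fin q) → Set where
    seed : ∀ v → Growth (v ∷ []) []
    grow : ∀ {S Ep j s w} → Growth S Ep → s ∈ₗ S → w ∉ₗ S → Joins j s w → Growth (w ∷ S) (j ∷ Ep)

  Growth-ends : ∀ {S Ep j} → Growth S Ep → j ∈ₗ Ep → end₁ j ∈ₗ S × end₂ j ∈ₗ S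
  Growth-ends (grow γ s∈S w∉S (inj₁ eq)) (here refl) rewrite eq = there s∈S , here refl
  Growth-ends (grow γ s∈S w∉S (inj₂ eq)) (here refl) rewrite eq = here refl , there s∈S
  Growth-ends (grow γ _ _ _) (there j∈Ep) = let (∈₁ , ∈₂) = Growth-ends γ j∈Ep in there ∈₁ , there ∈₂

  Growth-endpoint : ∀ {S Ep j u} → Growth S Ep → j ∈ₗ Ep → Endpoint j u → u ∈ₗ S
  Growth-endpoint {S} γ j∈Ep (inj₁ refl) = proj₁ (Growth-ends γ j∈Ep)
  Growth-endpoint {S} γ j∈Ep (inj₂ refl) = proj₂ (Growth-ends γ j∈Ep)

  Growth-new-edge : ∀ {S Ep j s w} → Growth S Ep → w ∉ₗ S → Joins j s w → j ∉ₗ Ep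
  Growth-new-edge γ w∉S j~ j∈Ep = w∉S (uncurry (Joins-∈ j~) (Growth-ends γ j∈Ep))

  Growth-unique : ∀ {S Ep} → Growth S Ep → Unique Ep
  Growth-unique (seed v) = []
  Growth-unique (grow γ _ w∉S j~) = All.¬Any⇒All¬ _ (Growth-new-edge γ w∉S j~) ∷ Growth-unique γ

  Growth-length : ∀ {S Ep} → Growth S Ep → length S ≡ suc (length Ep)
  Growth-length (seed v) = refl
  Growth-length (grow γ _ _ _) = cong suc (Growth-length γ)

  Growth-nonempty : ∀ {S Ep} → Growth S Ep → ∃[ v ] (v ∈ₗ S)
  Growth-nonempty (seed v) = v , here refl
  Growth-nonempty (grow {w = w} _ _ _ _) = w , here refl

  private
    ∉-outside : ∀ {S : List (Fin n)} {vs w} → All (_∈ₗ S) vs → w ∉ₗ S → w ∉ₗ vs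
    ∉-outside vs⊆S w∉S w∈vs = w∉S (All.lookup vs⊆S w∈vs)

  Growth-connected : ∀ {S Ep} → Growth S Ep → ∀ {u t} → u ∈ₗ S → t ∈ₗ S →
    ∃[ vs ] (Path u t vs × Unique vs × All (_∈ₗ S) vs)
  Growth-connected (seed v) (here refl) (here refl) = v ∷ [] , [ v ] , [] ∷ [] , here refl ∷ []
  Growth-connected (grow {w = w} _ _ _ _) (here refl) (here refl) = w ∷ [] , [ w ] , [] ∷ [] , here refl ∷ []
  Growth-connected (grow {j = j} {w = w} γ s∈S w∉S j~) (here refl) (there t∈S) =
    let (vs , p , uniq , vs⊆S) = Growth-connected γ s∈S t∈S in
    w ∷ vs , (j , Joins-sym j~) ∷ p , All.¬Any⇒All¬ _ (∉-outside vs⊆S w∉S) ∷ uniq , here refl ∷ All.map there vs⊆S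
  Growth-connected (grow {j = j} {w = w} γ s∈S w∉S j~) (there u∈S) (here refl) =
    let (vs , p , uniq , vs⊆S) = Growth-connected γ u∈S s∈S in
    vs ∷ʳ w , p ∷ʳᵖ (j , j~) , Unique-∷ʳ uniq (∉-outside vs⊆S w∉S) , All.++⁺ (All.map there vs⊆S) (here refl ∷ [])
  Growth-connected (grow γ _ _ _) (there u∈S) (there t∈S) =
    let (vs , p , uniq , vs⊆S) = Growth-connected γ u∈S t∈S in vs , p , uniq , All.map there vs⊆S

  -- A second edge from the new vertex w into S would close a cycle through the path inside S (or be parallel to j).
  Growth-single-attachment : ¬ HasCycle G → ∀ {S Ep j j′ s s′ w} → Growth S Ep → s ∈ₗ S → w ∉ₗ S →
    Joins j s w → j′ ≢ j → s′ ∈ₗ S → ¬ Joins j′ s′ w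
  Growth-single-attachment acyclic {s = s} {s′} {w} γ s∈S w∉S j~ j′≢j s′∈S j′~ with s′ ≟ᶠ s
  ... | yes refl = simple G _ _ (j′≢j ∘ sym) (Joins-parallel j~ j′~)
  ... | no s′≢s =
    let (vs , p , uniq , vs⊆S) = Growth-connected γ s′∈S s∈S in
    acyclic (w , vs , Path-length p s′≢s , All.¬Any⇒All¬ _ (∉-outside vs⊆S w∉S) ∷ uniq ,
             Path⇒Linked ((_ , Joins-sym j′~) ∷ (p ∷ʳᵖ (_ , j~))))

  Growth-induced : ¬ HasCycle G → ∀ {S Ep} → Growth S Ep → ∀ j → end₁ j ∈ₗ S → end₂ j ∈ₗ S → j ∈ₗ Ep
  Growth-induced _ (seed v) j (here e₁≡v) (here e₂≡v) = contradiction (trans e₁≡v (sym e₂≡v)) (loopless G j)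
  Growth-induced acyclic (grow {j = j} γ s∈S w∉S j~) j′ ∈₁ ∈₂ with j′ ≟ᶠ j
  ... | yes refl = here refl
  ... | no j′≢j with ∈₁ | ∈₂
  ...   | here e₁≡w | here e₂≡w = contradiction (trans e₁≡w (sym e₂≡w)) (loopless G j′)
  ...   | here e₁≡w | there e₂∈S =
    ⊥-elim (Growth-single-attachment acyclic γ s∈S w∉S j~ j′≢j e₂∈S (inj₂ (cong (_, end₂ j′) e₁≡w)))
  ...   | there e₁∈S | here e₂≡w =
    ⊥-elim (Growth-single-attachment acyclic γ s∈S w∉S j~ j′≢j e₁∈S (inj₁ (cong (end₁ j′ ,_) e₂≡w)))
  ...   | there e₁∈S | there e₂∈S = there (Growth-induced acyclic γ j′ e₁∈S e₂∈S)

  Crossing : List (Fin n) → Fin q → Set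
  Crossing S j = (end₁ j ∈ₗ S × end₂ j ∉ₗ S) ⊎ (end₁ j ∉ₗ S × end₂ j ∈ₗ S)

  crossing? : ∀ S j → Dec (Crossing S j)
  crossing? S j = ((end₁ j ∈ₗ? S) ×-dec ¬? (end₂ j ∈ₗ? S)) ⊎-dec (¬? (end₁ j ∈ₗ? S) ×-dec (end₂ j ∈ₗ? S))

  Crossing⇒attachment : ∀ {S j} → Crossing S j → ∃[ s ] ∃[ w ] (s ∈ₗ S × w ∉ₗ S × Joins j s w)
  Crossing⇒attachment (inj₁ (∈₁ , ∉₂)) = _ , _ , ∈₁ , ∉₂ , inj₁ refl
  Crossing⇒attachment (inj₂ (∉₁ , ∈₂)) = _ , _ , ∈₂ , ∉₁ , inj₂ refl

  ¬Crossing⇒closed : ∀ {S} → (∀ j → ¬ Crossing S j) → ∀ {u t} → Star (Adj G) u t → u ∈ₗ S → t ∈ₗ S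
  ¬Crossing⇒closed no-crossing ε u∈S = u∈S
  ¬Crossing⇒closed {S} no-crossing {u} (_◅_ {j = v} (j , j~) v⇝t) u∈S with v ∈ₗ? S
  ... | yes v∈S = ¬Crossing⇒closed no-crossing v⇝t v∈S
  ... | no v∉S = contradiction (crossing j~) (no-crossing j)
    where
    crossing : Joins j u v → Crossing S j
    crossing (inj₁ eq) = inj₁ (subst (_∈ₗ S) (sym (cong proj₁ eq)) u∈S , subst (_∉ₗ S) (sym (cong proj₂ eq)) v∉S)
    crossing (inj₂ eq) = inj₂ (subst (_∉ₗ S) (sym (cong proj₁ eq)) v∉S , subst (_∈ₗ S) (sym (cong proj₂ eq)) u∈S)

  Growth-maximal : Connected G → ∀ {S Ep} → Growth S Ep → (k : ℕ) → length Ep + k ≡ q →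
    ∃[ S′ ] ∃[ Ep′ ] (Growth S′ Ep′ × (∀ u → u ∈ₗ S′))
  Growth-maximal connected {S} {Ep} γ k |Ep|+k≡q with any? (crossing? S)
  ... | no ¬crossing =
    let (v , v∈S) = Growth-nonempty γ in
    S , Ep , γ , λ u → ¬Crossing⇒closed (λ j c → ¬crossing (j , c)) (connected v u) v∈S
  ... | yes (j , c) with Crossing⇒attachment c | k
  ...   | s , w , s∈S , w∉S , j~ | zero =
    contradiction (Unique⇒length≤ (All.¬Any⇒All¬ _ (Growth-new-edge γ w∉S j~) ∷ Growth-unique γ))
                  (ℕ.<⇒≱ (s≤s (ℕ.≤-reflexive (trans (sym |Ep|+k≡q) (ℕ.+-identityʳ _)))))
  ...   | s , w , s∈S , w∉S , j~ | suc k =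
    Growth-maximal connected (grow γ s∈S w∉S j~) k (trans (sym (ℕ.+-suc (length Ep) k)) |Ep|+k≡q)

  spanning-growth : IsTree G → Fin n → ∃[ S ] ∃[ Ep ] (Growth S Ep × (∀ u → u ∈ₗ S) × (∀ j → j ∈ₗ Ep))
  spanning-growth (connected , acyclic) v with Growth-maximal connected (seed v) q refl
  ... | S , Ep , γ , spans = S , Ep , γ , spans , λ j → Growth-induced acyclic γ j (spans _) (spans _)

module Embedding {r₂ n q} (G : Graph n q) {J : Subset (suc (suc r₂)) → Set} {H : PGraph (suc (suc r₂))}
  (hom : Homogeneous (suc (suc r₂) * q) J H) {a b} (a≢b : a ≢ b) (Ja : J ⁅ a ⁆) (Jb : J ⁅ b ⁆) where

  R : ℕ
  R = suc (suc r₂)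

  part : Bool → Fin R
  part true = a
  part false = b

  J-part : ∀ c → J ⁅ part c ⁆
  J-part true = Ja
  J-part false = Jb

  part-injective : ∀ {c c′} → part c ≡ part c′ → c ≡ c′
  part-injective {true} {true} _ = refl
  part-injective {false} {false} _ = refl
  part-injective {true} {false} a≡b = contradiction a≡b a≢b
  part-injective {false} {true} b≡a = contradiction (sym b≡a) a≢b

  punchIn₂≢part : ∀ k c → punchIn₂ a≢b k ≢ part c
  punchIn₂≢part k true = punchIn₂≢a a≢b k
  punchIn₂≢part k false = punchIn₂≢b a≢b k

  image : (Fin n → Bool) → (Fin n → ℕ) → Fin n → Vertex R
  image side x u = part (side u) , x u

  pad : (Fin q → Edge R) → Fin q → Fin r₂ → Vertex R
  pad h j k = punchIn₂ a≢b k , lookup (h j) (punchIn₂ a≢b k)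

  pads : (Fin q → Edge R) → List (Fin q) → List (Vertex R)
  pads h [] = []
  pads h (j ∷ Ep) = tabulate (pad h j) ++ pads h Ep

  length-pads : ∀ h Ep → length (pads h Ep) ≡ r₂ * length Ep
  length-pads h [] = sym (ℕ.*-zeroʳ r₂)
  length-pads h (j ∷ Ep) = begin
    length (tabulate (pad h j) ++ pads h Ep)         ≡⟨ L.length-++ (tabulate (pad h j)) ⟩
    length (tabulate (pad h j)) + length (pads h Ep) ≡⟨ cong₂ _+_ (L.length-tabulate (pad h j)) (length-pads h Ep) ⟩
    r₂ + r₂ * length Ep                              ≡⟨ ℕ.*-suc r₂ (length Ep) ⟨
    r₂ * suc (length Ep)                             ∎
    where open ≡-Reasoning

  ∈-pads : ∀ h {j Ep} k → j ∈ₗ Ep → pad h j k ∈ₗ pads h Ep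
  ∈-pads h k (here refl) = ∈-++⁺ˡ (∈-tabulate⁺ k)
  ∈-pads h k (there j∈Ep) = ∈-++⁺ʳ _ (∈-pads h k j∈Ep)

  record PartialEmbedding (S : List (Fin n)) (Ep : List (Fin q)) : Set where
    field
      side : Fin n → Bool
      x    : Fin n → ℕ
      h    : Fin q → Edge R
      h∈H             : ∀ {j} → j ∈ₗ Ep → h j ∈ₗ H
      ends-split      : ∀ {j} → j ∈ₗ Ep → side (end₁ G j) ≢ side (end₂ G j)
      endpoint∈       : ∀ {j u} → j ∈ₗ Ep → Endpoint G j u → image side x u ∈E h j
      image-injective : ∀ {u u′} → u ∈ₗ S → u′ ∈ₗ S → image side x u ≡ image side x u′ → u ≡ u′
      pad-injective   : ∀ {j j′ k} → j ∈ₗ Ep → j′ ∈ₗ Ep → pad h j k ≡ pad h j′ k → j ≡ j′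
      image-on-edge   : ∀ {u} → u ∈ₗ S → ∃[ e ] (e ∈ₗ H × image side x u ∈E e)

    used : List (Vertex R)
    used = L.map (image side x) S ++ pads h Ep

  seed-embedding : ∀ {e} → e ∈ₗ H → ∀ v → PartialEmbedding (v ∷ []) []
  seed-embedding {e} e∈H v = record
    { side = const true ; x = const (lookup e a) ; h = const e
    ; h∈H = λ () ; ends-split = λ () ; endpoint∈ = λ ()
    ; image-injective = λ { (here refl) (here refl) _ → refl }
    ; pad-injective = λ ()
    ; image-on-edge = λ { (here refl) → e , e∈H , refl } }

  padded-size : ∀ {e} → e < q → suc e + r₂ * e < R * q
  padded-size {e} e<q = begin-strict
    suc e + r₂ * e  ≤⟨ ℕ.+-mono-≤ e<q (ℕ.*-monoʳ-≤ r₂ (ℕ.<⇒≤ e<q)) ⟩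
    q + r₂ * q      <⟨ ℕ.*-monoˡ-< q {{ℕ.>-nonZero (ℕ.≤-<-trans z≤n e<q)}} (ℕ.n<1+n (suc r₂)) ⟩
    R * q           ∎
    where open ℕ.≤-Reasoning

  module _ {S Ep} (γ : Growth G S Ep) (π : PartialEmbedding S Ep) where
    open PartialEmbedding π

    length-used : length used ≡ suc (length Ep) + r₂ * length Ep
    length-used = begin
      length (L.map (image side x) S ++ pads h Ep)         ≡⟨ L.length-++ (L.map (image side x) S) ⟩
      length (L.map (image side x) S) + length (pads h Ep) ≡⟨ cong₂ _+_ |S| (length-pads h Ep) ⟩
      suc (length Ep) + r₂ * length Ep                     ∎
      where
      open ≡-Reasoning
      |S| = trans (L.length-map _ S) (Growth-length G γ)

    used-short : ∀ {j s w} → s ∈ₗ S → w ∉ₗ S → Joins G j s w → length used < R * q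
    used-short s∈S w∉S j~ = subst (_< R * q) (sym length-used)
      (padded-size (Unique⇒length≤ (Growth-unique G (grow γ s∈S w∉S j~))))

    -- w is placed on the other side of s, at a petal through the image of s that avoids everything used so far.
    extend : ∀ {j s w} → s ∈ₗ S → w ∉ₗ S → Joins G j s w → PartialEmbedding (w ∷ S) (j ∷ Ep)
    extend {j} {s} {w} s∈S w∉S j~ with image-on-edge s∈S
    ... | e , e∈H , s∈e with petal hom (J-part (side s)) e∈H s∈e used (used-short s∈S w∉S j~)
    ... | P , P∈H , s∈P , P-avoids = record
      { side = side′ ; x = x′ ; h = h′
      ; h∈H = h∈H′ ; ends-split = ends-split′ ; endpoint∈ = endpoint∈′
      ; image-injective = image-injective′ ; pad-injective = pad-injective′ ; image-on-edge = image-on-edge′ }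
      where
      c̄ = not (side s)
      side′ = updateAt side w (const c̄)
      x′ = updateAt x w (const (lookup P (part c̄)))
      h′ = updateAt h j (const P)
      image′ = image side′ x′

      j∉Ep : j ∉ₗ Ep
      j∉Ep = Growth-new-edge G γ w∉S j~

      ≢w : ∀ {u} → u ∈ₗ S → u ≢ w
      ≢w u∈S refl = w∉S u∈S

      old-side : ∀ {u} → u ∈ₗ S → side′ u ≡ side u
      old-side u∈S = updateAt-minimal _ w side (≢w u∈S)

      old-image : ∀ {u} → u ∈ₗ S → image′ u ≡ image side x u
      old-image u∈S = cong₂ _,_ (cong part (old-side u∈S)) (updateAt-minimal _ w x (≢w u∈S))

      new-side≢ : side′ w ≢ side′ s
      new-side≢ eq = not-≢ (side s) (trans (sym (updateAt-updates w side)) (trans eq (old-side s∈S)))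

      new-image : image′ w ≡ (part c̄ , lookup P (part c̄))
      new-image = cong₂ _,_ (cong part (updateAt-updates w side)) (updateAt-updates w x)

      old-h : ∀ {j′} → j′ ∈ₗ Ep → h′ j′ ≡ h j′
      old-h j′∈Ep = updateAt-minimal _ j h λ { refl → j∉Ep j′∈Ep }

      new-h : h′ j ≡ P
      new-h = updateAt-updates j h

      old-pad : ∀ {j′ k} → j′ ∈ₗ Ep → pad h′ j′ k ≡ pad h j′ k
      old-pad {k = k} j′∈Ep = cong (λ f → punchIn₂ a≢b k , lookup f (punchIn₂ a≢b k)) (old-h j′∈Ep)

      w∈P : image′ w ∈E P
      w∈P = subst (_∈E P) (sym new-image) refl

      s∈P′ : image′ s ∈E P
      s∈P′ = subst (_∈E P) (sym (old-image s∈S)) s∈P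

      used-in-P : ∀ {v} → v ∈ₗ used → v ∈E P → proj₁ v ≡ part (side s)
      used-in-P v∈used v∈P = cong proj₁ (P-avoids _ v∈used v∈P)

      new-image-fresh : ∀ {u} → u ∈ₗ S → image′ w ≢ image side x u
      new-image-fresh u∈S eq = not-≢ (side s) (part-injective (trans
        (cong proj₁ (trans (sym new-image) eq))
        (used-in-P (∈-++⁺ˡ (∈-map⁺ (image side x) u∈S)) (subst (_∈E P) eq w∈P))))

      new-pad-fresh : ∀ {j′ k} → j′ ∈ₗ Ep → pad h′ j k ≢ pad h j′ k
      new-pad-fresh {k = k} j′∈Ep eq = punchIn₂≢part k (side s)
        (used-in-P (∈-++⁺ʳ _ (∈-pads h k j′∈Ep)) (subst (_∈E P) eq new-pad∈P))
        where
        new-pad∈P : pad h′ j k ∈E P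
        new-pad∈P = cong (λ f → lookup f (punchIn₂ a≢b k)) (sym new-h)

      h∈H′ : ∀ {j′} → j′ ∈ₗ j ∷ Ep → h′ j′ ∈ₗ H
      h∈H′ (here refl) = subst (_∈ₗ H) (sym new-h) P∈H
      h∈H′ (there j′∈Ep) = subst (_∈ₗ H) (sym (old-h j′∈Ep)) (h∈H j′∈Ep)

      ends-split′ : ∀ {j′} → j′ ∈ₗ j ∷ Ep → side′ (end₁ G j′) ≢ side′ (end₂ G j′)
      ends-split′ (here refl) with Joins-ends G j~
      ... | inj₁ (e₁≡s , e₂≡w) = subst₂ (λ u u′ → side′ u ≢ side′ u′) (sym e₁≡s) (sym e₂≡w) (new-side≢ ∘ sym)
      ... | inj₂ (e₁≡w , e₂≡s) = subst₂ (λ u u′ → side′ u ≢ side′ u′) (sym e₁≡w) (sym e₂≡s) new-side≢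
      ends-split′ (there j′∈Ep) = let (e₁∈S , e₂∈S) = Growth-ends G γ j′∈Ep in
        subst₂ _≢_ (sym (old-side e₁∈S)) (sym (old-side e₂∈S)) (ends-split j′∈Ep)

      endpoint∈′ : ∀ {j′ u} → j′ ∈ₗ j ∷ Ep → Endpoint G j′ u → image′ u ∈E h′ j′
      endpoint∈′ (here refl) u-end with Joins-endpoint G j~ u-end
      ... | inj₁ refl = subst (image′ s ∈E_) (sym new-h) s∈P′
      ... | inj₂ refl = subst (image′ w ∈E_) (sym new-h) w∈P
      endpoint∈′ (there j′∈Ep) u-end =
        subst₂ _∈E_ (sym (old-image (Growth-endpoint G γ j′∈Ep u-end))) (sym (old-h j′∈Ep)) (endpoint∈ j′∈Ep u-end)

      image-injective′ : ∀ {u u′} → u ∈ₗ w ∷ S → u′ ∈ₗ w ∷ S → image′ u ≡ image′ u′ → u ≡ u′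
      image-injective′ (here refl) (here refl) _ = refl
      image-injective′ (here refl) (there u′∈S) eq = contradiction (trans eq (old-image u′∈S)) (new-image-fresh u′∈S)
      image-injective′ (there u∈S) (here refl) eq = contradiction (trans (sym eq) (old-image u∈S)) (new-image-fresh u∈S)
      image-injective′ (there u∈S) (there u′∈S) eq =
        image-injective u∈S u′∈S (trans (sym (old-image u∈S)) (trans eq (old-image u′∈S)))

      pad-injective′ : ∀ {j₁ j₂ k} → j₁ ∈ₗ j ∷ Ep → j₂ ∈ₗ j ∷ Ep → pad h′ j₁ k ≡ pad h′ j₂ k → j₁ ≡ j₂
      pad-injective′ (here refl) (here refl) _ = refl
      pad-injective′ (here refl) (there j₂∈Ep) eq = contradiction (trans eq (old-pad j₂∈Ep)) (new-pad-fresh j₂∈Ep)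
      pad-injective′ (there j₁∈Ep) (here refl) eq = contradiction (trans (sym eq) (old-pad j₁∈Ep)) (new-pad-fresh j₁∈Ep)
      pad-injective′ (there j₁∈Ep) (there j₂∈Ep) eq =
        pad-injective j₁∈Ep j₂∈Ep (trans (sym (old-pad j₁∈Ep)) (trans eq (old-pad j₂∈Ep)))

      image-on-edge′ : ∀ {u} → u ∈ₗ w ∷ S → ∃[ e′ ] (e′ ∈ₗ H × image′ u ∈E e′)
      image-on-edge′ (here refl) = P , P∈H , w∈P
      image-on-edge′ (there u∈S) =
        let (e′ , e′∈H , u∈e′) = image-on-edge u∈S in e′ , e′∈H , subst (_∈E e′) (sym (old-image u∈S)) u∈e′

  embed : ∀ {e} → e ∈ₗ H → ∀ {S Ep} → Growth G S Ep → PartialEmbedding S Ep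
  embed e∈H (seed v) = seed-embedding e∈H v
  embed e∈H (grow γ s∈S w∉S j~) = extend γ (embed e∈H γ) s∈S w∉S j~

  outside-parts : ∀ {c c′ p} → c ≢ c′ → p ≢ part c → p ≢ part c′ → p ≢ a × p ≢ b
  outside-parts {true} {true} c≢c′ _ _ = contradiction refl c≢c′
  outside-parts {false} {false} c≢c′ _ _ = contradiction refl c≢c′
  outside-parts {true} {false} _ p≢a p≢b = p≢a , p≢b
  outside-parts {false} {true} _ p≢b p≢a = p≢a , p≢b

  complete⇒expansion : ∀ {S Ep} → PartialEmbedding S Ep → (∀ u → u ∈ₗ S) → (∀ j → j ∈ₗ Ep) →
    ContainsExpansion {r = R} G H
  complete⇒expansion π all∈S all∈Ep =
    φ , φ-injective , λ j → h j , h∈H (all∈Ep j) , λ v → mk⇔ (covered j v) (on-edge j v)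
    where
    open PartialEmbedding π

    φ : ExpVertex n q R → Vertex R
    φ (inj₁ u) = image side x u
    φ (inj₂ (j , k)) = pad h j k

    φ-injective : Injective _≡_ _≡_ φ
    φ-injective {inj₁ u} {inj₁ u′} eq = cong inj₁ (image-injective (all∈S u) (all∈S u′) eq)
    φ-injective {inj₁ u} {inj₂ (j , k)} eq = contradiction (sym (cong proj₁ eq)) (punchIn₂≢part k (side u))
    φ-injective {inj₂ (j , k)} {inj₁ u} eq = contradiction (cong proj₁ eq) (punchIn₂≢part k (side u))
    φ-injective {inj₂ (j , k)} {inj₂ (j′ , k′)} eq with punchIn₂-injective a≢b (cong proj₁ eq)
    ... | refl = cong (λ j → inj₂ (j , k)) (pad-injective (all∈Ep j) (all∈Ep j′) eq)

    on-edge : ∀ j v → ∃[ y ] (InExpEdge G R j y × φ y ≡ v) → v ∈E h j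
    on-edge j _ (inj₁ u , u-end , refl) = endpoint∈ (all∈Ep j) u-end
    on-edge j _ (inj₂ (_ , k) , refl , refl) = refl

    covered : ∀ j v → v ∈E h j → ∃[ y ] (InExpEdge G R j y × φ y ≡ v)
    covered j (p , _) refl with p ≟ᶠ part (side (end₁ G j)) | p ≟ᶠ part (side (end₂ G j))
    ... | yes refl | _ = inj₁ (end₁ G j) , inj₁ refl , cong (_ ,_) (sym (endpoint∈ (all∈Ep j) (inj₁ refl)))
    ... | no _ | yes refl = inj₁ (end₂ G j) , inj₂ refl , cong (_ ,_) (sym (endpoint∈ (all∈Ep j) (inj₂ refl)))
    ... | no p≢₁ | no p≢₂ with outside-parts (ends-split (all∈Ep j)) p≢₁ p≢₂
    ...   | p≢a , p≢b with punchIn₂-onto a≢b p≢a p≢b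
    ...     | k , refl = inj₂ (j , k) , refl , refl

lemma4p10 : (q r : ℕ) → 1 ≤ q → 4 ≤ r →
    (n : ℕ) (G : Graph n q) → IsTree G →
    (J : Subset r → Set) (H : List (Vec ℕ r)) →
    (∃[ e ] (e ∈ₗ H)) → Homogeneous (r * q) J H →
    RankAtLeast J (r ∸ 1) → ¬ Central J →
    ContainsExpansion {r = r} G H
lemma4p10 (suc _) _ (s≤s z≤n) 4≤r@(s≤s (s≤s (s≤s (s≤s _)))) n G tree J H (e , e∈H)
          hom@(∩-closed , I≡J , _) rank noncentral
  with two-singletons 4≤r ∩-closed (J-decidable (I≡J e e∈H)) (⊤∉J (I≡J e e∈H)) rank noncentral
... | a , b , a≢b , Ja , Jb =
  let (S , Ep , γ , all∈S , all∈Ep) = spanning-growth G tree (end₁ G Fin.zero)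
  in complete⇒expansion (embed e∈H γ) all∈S all∈Ep
  where open Embedding G hom a≢b Ja Jb
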